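{- The approximation ratio of any Disjoint Matching algorithm for Optimisation Polyamorous Scheduling is $\Omega(\log n)$, where $n$ is the number of persons (vertices) of the instance.
   Context: An OPS instance $(P,R,g)$ consists of a finite simple undirected graph $(P,R)$ with growth rates $g:R\to\mathbb R_{>0}$. A schedule $S:\mathbb N_0\to 2^R$ is valid if every $S(t)$ is a matching; its heat is $h(S)=\max_{e\in R} g(e) r_S(e)$, where the recurrence time $r_S(e)$ is the maximal number of days between consecutive occurrences of $e$ (formally, the supremum of $d+1$ over $d\in\mathbb N$ such that $e\notin S(t)\cup\dots\cup S(t+d-1)$ for some $t$, and $1$ if no such $d$ exists). A Disjoint Matching algorithm is an algorithm for OPS whose output schedules use only pairwise disjoint matchings, i.e. each edge belongs to exactly one of the distinct matchings appearing in the schedule (the schedule partitions the edges into disjoint matchings and schedules these matchings as atomic units). The approximation ratio of an algorithm is the supremum over instances of the heat of its output divided by the optimal heat. -}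

module Defs where

open import Data.Nat as ℕ using (ℕ; zero; suc; _+_)
open import Data.Nat.Logarithm using (⌊log₂_⌋)
open import Data.Fin as Fin using (Fin)
open import Data.Bool using (Bool; true; false; T)
open import Data.Product using (Σ; Σ-syntax; ∃; ∃-syntax; _×_; _,_; proj₁; proj₂)
open import Data.Sum using (_⊎_)
open import Data.Integer using (+_)
open import Data.Rational using (ℚ; 0ℚ; _*_; _/_; _≤_; _<_)
open import Relation.Binary.PropositionalEquality using (_≡_)
open import Relation.Nullary using (¬_)

ℕ→ℚ : ℕ → ℚ
ℕ→ℚ n = (+ n) / 1

-- Persons are Fin n.  An (undirected, loop-free) potential edge {i,j} is
-- represented canonically as an ordered pair (i , j) with i < j.
Edge : ℕ → Set
Edge n = Σ[ i ∈ Fin n ] Σ[ j ∈ Fin n ] (i Fin.< j)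

src : ∀ {n} → Edge n → Fin n
src (i , _ , _) = i

tgt : ∀ {n} → Edge n → Fin n
tgt (_ , j , _) = j

SameEdge : ∀ {n} → Edge n → Edge n → Set
SameEdge e f = (src e ≡ src f) × (tgt e ≡ tgt f)

ShareVertex : ∀ {n} → Edge n → Edge n → Set
ShareVertex e f =
  (src e ≡ src f) ⊎ (src e ≡ tgt f) ⊎ (tgt e ≡ src f) ⊎ (tgt e ≡ tgt f)

-- An OPS instance on n persons: a finite simple graph (Fin n, R)
-- (R given as a decidable edge set) with positive growth rates on R.
record Instance (n : ℕ) : Set where
  field
    R     : Edge n → Bool
    g     : Edge n → ℚ
    g-pos : ∀ e → T (R e) → 0ℚ < g e
open Instance public

Schedule : ℕ → Set
Schedule n = ℕ → Edge n → Bool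

IsMatching : ∀ {n} → Instance n → (Edge n → Bool) → Set
IsMatching I M =
  (∀ e → T (M e) → T (R I e)) ×
  (∀ e f → T (M e) → T (M f) → ¬ SameEdge e f → ¬ ShareVertex e f)

Valid : ∀ {n} → Instance n → Schedule n → Set
Valid I S = ∀ t → IsMatching I (S t)

Absent : ∀ {n} → Schedule n → Edge n → ℕ → ℕ → Set
Absent S e t d = ∀ k → k ℕ.< d → S (t + k) e ≡ false

-- h(S) ≤ H, i.e. g(e) · r_S(e) ≤ H for every edge e ∈ R, where r_S(e) is
-- the supremum of d+1 over all gaps d (d = 0 is always a gap, giving the
-- default value 1).  An edge occurring only finitely often has unbounded
-- gaps, so no H works (heat = ∞).
HeatAtMost : ∀ {n} → Instance n → Schedule n → ℚ → Set
HeatAtMost I S H =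
  ∀ e → T (R I e) → ∀ t d → Absent S e t d → g I e * ℕ→ℚ (suc d) ≤ H

-- Disjoint-matching schedule: the distinct matchings appearing in S are
-- pairwise disjoint (two days sharing an edge use the same matching) and
-- every edge of R belongs to one of them.
DisjointMatchings : ∀ {n} → Instance n → Schedule n → Set
DisjointMatchings I S =
  (∀ t t' e → T (S t e) → T (S t' e) → ∀ f → S t f ≡ S t' f) ×
  (∀ e → T (R I e) → ∃[ t ] T (S t e))

record DMAlgorithm : Set where
  field
    run   : ∀ {n} → Instance n → Schedule n
    valid : ∀ {n} (I : Instance n) → Valid I (run I)
    dm    : ∀ {n} (I : Instance n) → DisjointMatchings I (run I)
open DMAlgorithm public

-- "The approximation ratio of A on instances with n persons is > ρ":
-- some instance I and some valid schedule S' with h(S') ≤ H satisfy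
-- h(A(I)) > ρ · H  (hence h(A(I)) / OPT(I) > ρ).
RatioExceeds : DMAlgorithm → (n : ℕ) → ℚ → Set
RatioExceeds A n ρ =
  ∃[ I ] ∃[ S ] ∃[ H ] (Valid {n} I S × HeatAtMost I S H × ¬ HeatAtMost I (run A I) (ρ * H))

-- Approximation ratio of A on n-person instances is ≥ x  (sup ≥ x):
-- it exceeds every ρ < x.
RatioAtLeast : DMAlgorithm → ℕ → ℚ → Set
RatioAtLeast A n x = ∀ ρ → ρ < x → RatioExceeds A n ρ

{-# OPTIONS --safe #-}
module Submission where

-- Take the star forest with centers 0, …, k in which center j has 2^j leaves and its spokes
-- grow at rate 2^(k∸j); serving the leaves of each star round-robin gives heat 2^k.  A
-- disjoint-matching schedule of heat below q·2^k repeats every spoke of center j within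
-- q·2^j days.  Weigh a spoke of center j served on day t by 2^(k∸j)·2^c, where c is the
-- lowest center served that day.  A matching serves each center at most once, so a day
-- carries at most the geometric tail 2^(k+1).  Conversely, the matching containing a spoke
-- of center j contains a spoke of its lowest center c ≤ j, which recurs every q·2^c days and
-- brings the whole matching along; so in q·2^k days every spoke of center j collects at least
-- 2^(k∸j)·2^k.  Comparing the totals gives (k+1)·4^k ≤ 2q·4^k, so no disjoint-matching
-- schedule achieves ratio below (k+1)/2, and k can be taken close to log₂ n.

module FiniteSum where

  open import Data.Nat
  open import Data.Nat.Properties
  open import Data.Bool.Base using (Bool; true; false)
  open import Data.Product.Base using (∃-syntax; _×_; _,_)
  open import Data.Sum.Base using (inj₁; inj₂)
  open import Relation.Binary.PropositionalEquality
    using (_≡_; refl; sym; trans; cong; cong₂; subst; module ≡-Reasoning)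

  ∑< : ℕ → (ℕ → ℕ) → ℕ
  ∑< zero    f = 0
  ∑< (suc n) f = ∑< n f + f n

  syntax ∑< n (λ i → x) = ∑[ i < n ] x

  ∑-cong : ∀ n {f g : ℕ → ℕ} → (∀ i → i < n → f i ≡ g i) → ∑< n f ≡ ∑< n g
  ∑-cong zero    f≡g = refl
  ∑-cong (suc n) f≡g = cong₂ _+_ (∑-cong n (λ i i<n → f≡g i (m≤n⇒m≤1+n i<n))) (f≡g n ≤-refl)

  ∑-mono-≤ : ∀ n {f g : ℕ → ℕ} → (∀ i → i < n → f i ≤ g i) → ∑< n f ≤ ∑< n g
  ∑-mono-≤ zero    f≤g = z≤n
  ∑-mono-≤ (suc n) f≤g = +-mono-≤ (∑-mono-≤ n (λ i i<n → f≤g i (m≤n⇒m≤1+n i<n))) (f≤g n ≤-refl)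

  ∑-const : ∀ n c → ∑[ i < n ] c ≡ n * c
  ∑-const zero    c = refl
  ∑-const (suc n) c = trans (cong (_+ c) (∑-const n c)) (+-comm (n * c) c)

  ∑-distrib-+ : ∀ n (f g : ℕ → ℕ) → ∑[ i < n ] (f i + g i) ≡ ∑< n f + ∑< n g
  ∑-distrib-+ zero    f g = refl
  ∑-distrib-+ (suc n) f g = begin
    ∑[ i < n ] (f i + g i) + (f n + g n)  ≡⟨ cong (_+ (f n + g n)) (∑-distrib-+ n f g) ⟩
    ∑< n f + ∑< n g + (f n + g n)         ≡⟨ +-assoc (∑< n f) (∑< n g) (f n + g n) ⟩
    ∑< n f + (∑< n g + (f n + g n))       ≡⟨ cong (∑< n f +_) (x+[y+z]≡y+[x+z] (∑< n g) (f n) (g n)) ⟩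
    ∑< n f + (f n + (∑< n g + g n))       ≡⟨ +-assoc (∑< n f) (f n) (∑< n g + g n) ⟨
    ∑< n f + f n + (∑< n g + g n)         ∎
    where
    open ≡-Reasoning
    x+[y+z]≡y+[x+z] : ∀ x y z → x + (y + z) ≡ y + (x + z)
    x+[y+z]≡y+[x+z] x y z = trans (sym (+-assoc x y z)) (trans (cong (_+ z) (+-comm x y)) (+-assoc y x z))

  ∑-comm : ∀ m n (F : ℕ → ℕ → ℕ) → ∑[ i < m ] ∑[ j < n ] F i j ≡ ∑[ j < n ] ∑[ i < m ] F i j
  ∑-comm zero    n F = sym (trans (∑-const n 0) (*-zeroʳ n))
  ∑-comm (suc m) n F = trans (cong (_+ ∑[ j < n ] F m j) (∑-comm m n F))
                             (sym (∑-distrib-+ n (λ j → ∑[ i < m ] F i j) (F m)))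

  ∑-split : ∀ m n (f : ℕ → ℕ) → ∑< (m + n) f ≡ ∑< m f + ∑[ i < n ] f (m + i)
  ∑-split m zero    f = trans (cong (λ k → ∑< k f) (+-identityʳ m)) (sym (+-identityʳ (∑< m f)))
  ∑-split m (suc n) f = trans (cong (λ k → ∑< k f) (+-suc m n))
                              (trans (cong (_+ f (m + n)) (∑-split m n f)) (+-assoc (∑< m f) _ _))

  term≤∑ : ∀ n (f : ℕ → ℕ) {i} → i < n → f i ≤ ∑< n f
  term≤∑ (suc n) f {i} i<1+n with m≤n⇒m<n∨m≡n (s≤s⁻¹ i<1+n)
  ... | inj₁ i<n  = ≤-trans (term≤∑ n f i<n) (m≤m+n (∑< n f) (f n))
  ... | inj₂ refl = m≤n+m (f n) (∑< n f)

  *-distribʳ-∑ : ∀ n (f : ℕ → ℕ) c → ∑< n f * c ≡ ∑[ i < n ] (f i * c)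
  *-distribʳ-∑ zero    f c = refl
  *-distribʳ-∑ (suc n) f c = trans (*-distribʳ-+ c (∑< n f) (f n)) (cong (_+ f n * c) (*-distribʳ-∑ n f c))

  *-distribˡ-∑ : ∀ n c (f : ℕ → ℕ) → c * ∑< n f ≡ ∑[ i < n ] (c * f i)
  *-distribˡ-∑ zero    c f = *-zeroʳ c
  *-distribˡ-∑ (suc n) c f = trans (*-distribˡ-+ c (∑< n f) (f n)) (cong (_+ c * f n) (*-distribˡ-∑ n c f))

  [_] : Bool → ℕ
  [ true  ] = 1
  [ false ] = 0

  count : ℕ → (ℕ → Bool) → ℕ
  count n f = ∑[ i < n ] [ f i ]

  Recurs : ℕ → (ℕ → Bool) → Set
  Recurs P f = ∀ t → ∃[ s ] (s < P × f (t + s) ≡ true)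

  count-recurrent : ∀ {P f} → Recurs P f → ∀ m → m ≤ count (m * P) f
  count-recurrent             recurs zero    = z≤n
  count-recurrent {P} {f} recurs (suc m) = begin
    suc m                                              ≡⟨ +-comm 1 m ⟩
    m + 1                                              ≤⟨ +-mono-≤ (count-recurrent recurs m) one-in-block ⟩
    count (m * P) f + ∑[ s < P ] [ f (m * P + s) ]     ≡⟨ counted ⟨
    count (P + m * P) f                                ∎
    where
    open ≤-Reasoning
    counted : count (P + m * P) f ≡ count (m * P) f + ∑[ s < P ] [ f (m * P + s) ]
    counted = trans (cong (λ k → count k f) (+-comm P (m * P))) (∑-split (m * P) P (λ t → [ f t ]))
    one-in-block : 1 ≤ ∑[ s < P ] [ f (m * P + s) ]
    one-in-block with recurs (m * P)
    ... | s , s<P , fired =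
      subst (λ b → [ b ] ≤ ∑[ s < P ] [ f (m * P + s) ]) fired (term≤∑ P (λ s → [ f (m * P + s) ]) s<P)

module BoundedSearch where

  open import Data.Nat
  open import Data.Nat.Properties
  open import Data.Bool.Base using (Bool; true; false; _∨_; if_then_else_)
  open import Data.Bool.Properties using (∨-zeroʳ; ∨-identityʳ)
  open import Data.Empty using (⊥-elim)
  open import Data.Product.Base using (∃-syntax; _×_; _,_)
  open import Data.Sum.Base using (inj₁; inj₂)
  open import Function.Base using (_∘_)
  open import Relation.Binary.PropositionalEquality
    using (_≡_; refl; sym; trans; cong; cong₂)
  open FiniteSum

  any< : ℕ → (ℕ → Bool) → Bool
  any< zero    f = false
  any< (suc m) f = any< m f ∨ f m

  any<-intro : ∀ m (f : ℕ → Bool) {i} → i < m → f i ≡ true → any< m f ≡ true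
  any<-intro (suc m) f {i} i<1+m fi with m≤n⇒m<n∨m≡n (s≤s⁻¹ i<1+m)
  ... | inj₁ i<m  = cong (_∨ f m) (any<-intro m f i<m fi)
  ... | inj₂ refl = trans (cong (any< m f ∨_) fi) (∨-zeroʳ (any< m f))

  any<-elim : ∀ m (f : ℕ → Bool) → any< m f ≡ true → ∃[ i ] (i < m × f i ≡ true)
  any<-elim (suc m) f any-f with f m in fm
  ... | true  = m , ≤-refl , fm
  ... | false with any<-elim m f (trans (sym (∨-identityʳ (any< m f))) any-f)
  ...   | i , i<m , fi = i , m≤n⇒m≤1+n i<m , fi

  any<-cong : ∀ m {f g : ℕ → Bool} → (∀ i → f i ≡ g i) → any< m f ≡ any< m g
  any<-cong zero    f≡g = refl
  any<-cong (suc m) f≡g = cong₂ _∨_ (any<-cong m f≡g) (f≡g m)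

  count≤any< : ∀ m (f : ℕ → Bool) → (∀ {i i'} → f i ≡ true → f i' ≡ true → i ≡ i') →
               count m f ≤ [ any< m f ]
  count≤any< zero    f unique = z≤n
  count≤any< (suc m) f unique with f m in fm
  ... | false rewrite ∨-identityʳ (any< m f) | +-identityʳ (count m f) = count≤any< m f unique
  ... | true rewrite ∨-zeroʳ (any< m f) with any< m f in any-f | count≤any< m f unique
  ...   | false | count≤0 = +-monoˡ-≤ 1 count≤0
  ...   | true  | _ with any<-elim m f any-f
  ...     | i , i<m , fi = ⊥-elim (<-irrefl (unique fi fm) i<m)

  least : (ℕ → Bool) → ℕ → ℕ
  least p zero    = zero
  least p (suc n) = if p zero then zero else suc (least (p ∘ suc) n)

  least≤bound : ∀ (p : ℕ → Bool) n → least p n ≤ n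
  least≤bound p zero    = z≤n
  least≤bound p (suc n) with p zero
  ... | true  = z≤n
  ... | false = s≤s (least≤bound (p ∘ suc) n)

  least≤witness : ∀ (p : ℕ → Bool) n {j} → j < n → p j ≡ true → least p n ≤ j
  least≤witness p (suc n) {zero}  _     pj rewrite pj = z≤n
  least≤witness p (suc n) {suc j} j<1+n pj with p zero
  ... | true  = z≤n
  ... | false = s≤s (least≤witness (p ∘ suc) n (s≤s⁻¹ j<1+n) pj)

  least-holds : ∀ (p : ℕ → Bool) n {j} → j < n → p j ≡ true → p (least p n) ≡ true
  least-holds p (suc n) {zero}  _     pj rewrite pj = pj
  least-holds p (suc n) {suc j} j<1+n pj with p zero in p0
  ... | true  = p0
  ... | false = least-holds (p ∘ suc) n (s≤s⁻¹ j<1+n) pj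

  least-cong : ∀ n {p p' : ℕ → Bool} → (∀ j → p j ≡ p' j) → least p n ≡ least p' n
  least-cong zero    p≡p' = refl
  least-cong (suc n) p≡p' = cong₂ (λ b r → if b then zero else suc r) (p≡p' zero) (least-cong n (p≡p' ∘ suc))

module NatArithmetic where

  open import Data.Nat
  open import Data.Nat.Properties
  open import Data.Nat.Logarithm using (⌊log₂_⌋; ⌊log₂⌊n/2⌋⌋≡⌊log₂n⌋∸1)
  open import Data.Nat.DivMod using (_/_; _%_; [m+n]%n≡m%n; m<n⇒m%n≡m; m≡m%n+[m/n]*n; m%n<n; m/n*n≤m)
  open import Data.Product.Base using (∃-syntax; _×_; _,_)
  open import Relation.Nullary.Reflects using (ofʸ; ofⁿ)
  open import Data.Bool.Base using (true; false)
  open import Relation.Binary.PropositionalEquality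
    using (_≡_; sym; trans; cong; cong₂; subst)
  open import Data.Nat.Tactic.RingSolver using (solve-∀)
  open FiniteSum

  2^[k∸c]*2^c≡2^k : ∀ {c k} → c ≤ k → 2 ^ (k ∸ c) * 2 ^ c ≡ 2 ^ k
  2^[k∸c]*2^c≡2^k {c} {k} c≤k = trans (sym (^-distribˡ-+-* 2 (k ∸ c) c)) (cong (2 ^_) (m∸n+n≡m c≤k))

  n<2^n : ∀ n → n < 2 ^ n
  n<2^n zero    = s≤s z≤n
  n<2^n (suc n) = +-mono-≤ (m^n>0 2 n) (≤-trans (n<2^n n) (m≤m+n (2 ^ n) 0))

  n+2^n≤2^[1+n] : ∀ n → n + 2 ^ n ≤ 2 ^ suc n
  n+2^n≤2^[1+n] n = begin
    n + 2 ^ n          ≤⟨ +-monoˡ-≤ (2 ^ n) (<⇒≤ (n<2^n n)) ⟩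
    2 ^ n + 2 ^ n      ≡⟨ cong (2 ^ n +_) (+-identityʳ (2 ^ n)) ⟨
    2 ^ suc n          ∎
    where open ≤-Reasoning

  n*[1+m/n]≡n+[m/n]*n : ∀ m n .{{_ : NonZero n}} → n * suc (m / n) ≡ n + m / n * n
  n*[1+m/n]≡n+[m/n]*n m n = trans (*-suc n (m / n)) (cong (n +_) (*-comm n (m / n)))

  m<n*[1+m/n] : ∀ m n .{{_ : NonZero n}} → m < n * suc (m / n)
  m<n*[1+m/n] m n = begin-strict
    m                  ≡⟨ m≡m%n+[m/n]*n m n ⟩
    m % n + m / n * n  <⟨ +-monoˡ-< (m / n * n) (m%n<n m n) ⟩
    n + m / n * n      ≡⟨ n*[1+m/n]≡n+[m/n]*n m n ⟨
    n * suc (m / n)    ∎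
    where open ≤-Reasoning

  n*[1+m/n]≤n+m : ∀ m n .{{_ : NonZero n}} → n * suc (m / n) ≤ n + m
  n*[1+m/n]≤n+m m n = ≤-trans (≤-reflexive (n*[1+m/n]≡n+[m/n]*n m n)) (+-monoʳ-≤ n (m/n*n≤m m n))

  2^⌊log₂n⌋≤n : ∀ n .{{_ : NonZero n}} → 2 ^ ⌊log₂ n ⌋ ≤ n
  2^⌊log₂n⌋≤n (suc n) = 2^L≤n ⌊log₂ suc n ⌋ n ≤-refl
    where
    2^L≤n : ∀ L n → L ≤ ⌊log₂ suc n ⌋ → 2 ^ L ≤ suc n
    2^L≤n zero    n       _     = s≤s z≤n
    2^L≤n (suc L) (suc m) L<log = begin
      2 * 2 ^ L        ≤⟨ *-monoʳ-≤ 2 (2^L≤n L ⌊ m /2⌋ L≤log-half) ⟩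
      2 * suc ⌊ m /2⌋  ≡⟨ *-suc 2 ⌊ m /2⌋ ⟩
      2 + 2 * ⌊ m /2⌋  ≤⟨ +-monoʳ-≤ 2 twice-half≤ ⟩
      2 + m            ∎
      where
      open ≤-Reasoning
      L≤log-half : L ≤ ⌊log₂ suc ⌊ m /2⌋ ⌋
      L≤log-half = subst (L ≤_) (sym (⌊log₂⌊n/2⌋⌋≡⌊log₂n⌋∸1 (suc (suc m)))) (∸-monoˡ-≤ 1 L<log)
      twice-half≤ : 2 * ⌊ m /2⌋ ≤ m
      twice-half≤ = begin
        2 * ⌊ m /2⌋          ≡⟨ cong (⌊ m /2⌋ +_) (+-identityʳ ⌊ m /2⌋) ⟩
        ⌊ m /2⌋ + ⌊ m /2⌋    ≤⟨ +-monoʳ-≤ ⌊ m /2⌋ (⌊n/2⌋≤⌈n/2⌉ m) ⟩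
        ⌊ m /2⌋ + ⌈ m /2⌉    ≡⟨ ⌊n/2⌋+⌈n/2⌉≡n m ⟩
        m                    ∎

  doubled-tail : ∀ m c → ∑[ j < m ] ([ c ≤ᵇ j ] * 2 ^ (m ∸ j)) ≡ 2 * ∑[ j < m ] ([ c ≤ᵇ j ] * 2 ^ (m ∸ suc j))
  doubled-tail m c = trans (∑-cong m doubled-term) (sym (*-distribˡ-∑ m 2 _))
    where
    doubled-term : ∀ j → j < m → [ c ≤ᵇ j ] * 2 ^ (m ∸ j) ≡ 2 * ([ c ≤ᵇ j ] * 2 ^ (m ∸ suc j))
    doubled-term j j<m = trans (cong (λ e → [ c ≤ᵇ j ] * 2 ^ e) (+-∸-assoc 1 j<m))
                               (x*[2*y]≡2*[x*y] [ c ≤ᵇ j ] (2 ^ (m ∸ suc j)))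
      where
      x*[2*y]≡2*[x*y] : ∀ x y → x * (2 * y) ≡ 2 * (x * y)
      x*[2*y]≡2*[x*y] = solve-∀

  geometric-tail : ∀ m c → ∑[ j < m ] ([ c ≤ᵇ j ] * 2 ^ (m ∸ suc j)) < 2 ^ (m ∸ c)
  geometric-tail zero    c rewrite 0∸n≡0 c = s≤s z≤n
  geometric-tail (suc m) c with c ≤ᵇ m | ≤ᵇ-reflects-≤ c m | geometric-tail m c
  ... | true  | ofʸ c≤m | G<2^[m∸c] = begin-strict
    ∑[ j < m ] ([ c ≤ᵇ j ] * 2 ^ (m ∸ j)) + (2 ^ (m ∸ m) + 0)
      ≡⟨ cong₂ (λ x y → x + (2 ^ y + 0)) (doubled-tail m c) (n∸n≡0 m) ⟩
    2 * G + 1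
      <⟨ ≤-trans (≤-reflexive (suc[2x+1]≡2*suc[x] G)) (*-monoʳ-≤ 2 G<2^[m∸c]) ⟩
    2 * 2 ^ (m ∸ c)
      ≡⟨ cong (2 ^_) (+-∸-assoc 1 c≤m) ⟨
    2 ^ (suc m ∸ c)
      ∎
    where
    open ≤-Reasoning
    G = ∑[ j < m ] ([ c ≤ᵇ j ] * 2 ^ (m ∸ suc j))
    suc[2x+1]≡2*suc[x] : ∀ x → suc (2 * x + 1) ≡ 2 * suc x
    suc[2x+1]≡2*suc[x] = solve-∀
  ... | false | ofⁿ c≰m | G<2^[m∸c] = begin-strict
    ∑[ j < m ] ([ c ≤ᵇ j ] * 2 ^ (m ∸ j)) + 0  ≡⟨ cong (_+ 0) (doubled-tail m c) ⟩
    2 * G + 0                                  ≡⟨ cong (λ x → 2 * x + 0) (n<1⇒n≡0 G<1) ⟩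
    0                                          <⟨ m^n>0 2 (suc m ∸ c) ⟩
    2 ^ (suc m ∸ c)                            ∎
    where
    open ≤-Reasoning
    G = ∑[ j < m ] ([ c ≤ᵇ j ] * 2 ^ (m ∸ suc j))
    G<1 : G < 1
    G<1 = subst (λ e → G < 2 ^ e) (m≤n⇒m∸n≡0 (<⇒≤ (≰⇒> c≰m))) G<2^[m∸c]

  window-hits-residue : ∀ p .{{_ : NonZero p}} t {r} → r < p → ∃[ s ] (s < p × (t + s) % p ≡ r)
  window-hits-residue p       zero    {r} r<p = r , r<p , m<n⇒m%n≡m r<p
  window-hits-residue (suc p) (suc t) {r} r<p with window-hits-residue (suc p) t r<p
  ... | suc s , s<1+p , hit = s , <-trans (n<1+n s) s<1+p , trans (cong (_% suc p) (sym (+-suc t s))) hit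
  ... | zero  , _     , hit = p , n<1+n p , (begin-equality
    (suc t + p) % suc p  ≡⟨ cong (_% suc p) (sym (+-suc t p)) ⟩
    (t + suc p) % suc p  ≡⟨ [m+n]%n≡m%n t (suc p) ⟩
    t % suc p            ≡⟨ cong (_% suc p) (+-identityʳ t) ⟨
    (t + 0) % suc p      ≡⟨ hit ⟩
    r                    ∎)
    where open ≤-Reasoning

module Counting where
  open import Data.Nat
  open import Data.Nat.Properties
  open import Data.Nat.Tactic.RingSolver using (solve-∀)
  open import Data.Bool.Base using (Bool; true; false)
  open import Data.Product.Base using (∃-syntax; _×_; _,_)
  open import Relation.Nullary.Reflects using (ofʸ; ofⁿ)
  open import Relation.Nullary.Negation using (contradiction)
  open import Relation.Binary.PropositionalEquality
    using (_≡_; refl; sym; trans; cong; subst)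
  open FiniteSum
  open BoundedSearch
  open NatArithmetic

  -- occ t j i: on day t the schedule serves the spoke joining center j to its i-th leaf.
  module _
    (k q : ℕ) (occ : ℕ → ℕ → ℕ → Bool)
    (matching  : ∀ {t j i i'} → occ t j i ≡ true → occ t j i' ≡ true → i ≡ i')
    (disjoint  : ∀ {t t' j i} → occ t j i ≡ true → occ t' j i ≡ true → ∀ j' i' → occ t j' i' ≡ occ t' j' i')
    (recurrent : ∀ {j i} → j ≤ k → i < 2 ^ j → Recurs (q * 2 ^ j) (λ t → occ t j i))
    where

    present : ℕ → ℕ → Bool
    present t j = any< (2 ^ j) (occ t j)

    lowest : ℕ → ℕ
    lowest t = least (present t) (suc k)

    weight : ℕ → ℕ → ℕ → ℕ
    weight t j i = [ occ t j i ] * (2 ^ (k ∸ j) * 2 ^ lowest t)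

    horizon : ℕ
    horizon = q * 2 ^ k

    private
      present-by : ∀ {t j i} → i < 2 ^ j → occ t j i ≡ true → present t j ≡ true
      present-by {t} {j} i<2^j on = any<-intro (2 ^ j) (occ t j) i<2^j on

    lowest≤ : ∀ {t j i} → j ≤ k → i < 2 ^ j → occ t j i ≡ true → lowest t ≤ j
    lowest≤ {t} j≤k i<2^j on = least≤witness (present t) (suc k) (s≤s j≤k) (present-by i<2^j on)

    lowest-occupied : ∀ {t j i} → j ≤ k → i < 2 ^ j → occ t j i ≡ true →
                      ∃[ i₀ ] (i₀ < 2 ^ lowest t × occ t (lowest t) i₀ ≡ true)
    lowest-occupied {t} j≤k i<2^j on =
      any<-elim (2 ^ lowest t) (occ t (lowest t)) (least-holds (present t) (suc k) (s≤s j≤k) (present-by i<2^j on))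

    lowest-shared : ∀ {t t' j i} → occ t j i ≡ true → occ t' j i ≡ true → lowest t ≡ lowest t'
    lowest-shared on on' = least-cong (suc k) (λ j' → any<-cong (2 ^ j') (disjoint on on' j'))

    day-weight≤ : ∀ t → ∑[ j < suc k ] ∑[ i < 2 ^ j ] weight t j i ≤ 2 ^ suc k
    day-weight≤ t = begin
      ∑[ j < suc k ] ∑[ i < 2 ^ j ] weight t j i         ≤⟨ ∑-mono-≤ (suc k) row≤ ⟩
      ∑[ j < suc k ] ([ c ≤ᵇ j ] * 2 ^ (k ∸ j) * 2 ^ c)  ≡⟨ *-distribʳ-∑ (suc k) (λ j → [ c ≤ᵇ j ] * 2 ^ (k ∸ j)) (2 ^ c) ⟨
      ∑[ j < suc k ] ([ c ≤ᵇ j ] * 2 ^ (k ∸ j)) * 2 ^ c  ≤⟨ *-monoˡ-≤ (2 ^ c) (<⇒≤ (geometric-tail (suc k) c)) ⟩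
      2 ^ (suc k ∸ c) * 2 ^ c                            ≡⟨ 2^[k∸c]*2^c≡2^k (least≤bound (present t) (suc k)) ⟩
      2 ^ suc k                                          ∎
      where
      open ≤-Reasoning
      c = lowest t
      row≤ : ∀ j → j < suc k → ∑[ i < 2 ^ j ] weight t j i ≤ [ c ≤ᵇ j ] * 2 ^ (k ∸ j) * 2 ^ c
      row≤ j j<1+k = begin
        ∑[ i < 2 ^ j ] weight t j i   ≡⟨ *-distribʳ-∑ (2 ^ j) (λ i → [ occ t j i ]) w ⟨
        count (2 ^ j) (occ t j) * w    ≤⟨ *-monoˡ-≤ w (count≤any< (2 ^ j) (occ t j) matching) ⟩
        [ present t j ] * w            ≤⟨ present⇒c≤j (present t j) refl ⟩
        [ c ≤ᵇ j ] * 2 ^ (k ∸ j) * 2 ^ c ∎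
        where
        w = 2 ^ (k ∸ j) * 2 ^ c
        present⇒c≤j : ∀ b → present t j ≡ b → [ b ] * w ≤ [ c ≤ᵇ j ] * 2 ^ (k ∸ j) * 2 ^ c
        present⇒c≤j false _  = z≤n
        present⇒c≤j true  pr with c ≤ᵇ j | ≤ᵇ-reflects-≤ c j
        ... | true  | ofʸ _   = ≤-reflexive (sym (*-assoc 1 (2 ^ (k ∸ j)) (2 ^ c)))
        ... | false | ofⁿ c≰j = contradiction (least≤witness (present t) (suc k) j<1+k pr) c≰j

    edge-weight≥ : ∀ {j i} → j ≤ k → i < 2 ^ j → 2 ^ (k ∸ j) * 2 ^ k ≤ ∑[ t < horizon ] weight t j i
    edge-weight≥ {j} {i} j≤k i<2^j with recurrent j≤k i<2^j 0
    ... | s , _ , on-s with lowest-occupied j≤k i<2^j on-s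
    ...   | i₀ , i₀<2^c , on-s-c = begin
      2 ^ (k ∸ j) * 2 ^ k                          ≡⟨ rearranged ⟩
      2 ^ (k ∸ c) * w                              ≤⟨ *-monoˡ-≤ w occurrences ⟩
      count horizon (λ t → occ t c i₀) * w         ≡⟨ *-distribʳ-∑ horizon (λ t → [ occ t c i₀ ]) w ⟩
      ∑[ t < horizon ] ([ occ t c i₀ ] * w)        ≤⟨ ∑-mono-≤ horizon (λ t _ → dominated t) ⟩
      ∑[ t < horizon ] weight t j i                ∎
      where
      open ≤-Reasoning
      c = lowest s
      c≤k : c ≤ k
      c≤k = ≤-trans (lowest≤ j≤k i<2^j on-s) j≤k
      w = 2 ^ (k ∸ j) * 2 ^ c
      x*[y*z]≡y*[x*z] : ∀ x y z → x * (y * z) ≡ y * (x * z)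
      x*[y*z]≡y*[x*z] = solve-∀
      rearranged : 2 ^ (k ∸ j) * 2 ^ k ≡ 2 ^ (k ∸ c) * w
      rearranged = trans (cong (2 ^ (k ∸ j) *_) (sym (2^[k∸c]*2^c≡2^k c≤k)))
                         (x*[y*z]≡y*[x*z] (2 ^ (k ∸ j)) (2 ^ (k ∸ c)) (2 ^ c))
      occurrences : 2 ^ (k ∸ c) ≤ count horizon (λ t → occ t c i₀)
      occurrences = subst (λ h → 2 ^ (k ∸ c) ≤ count h (λ t → occ t c i₀))
                          (trans (x*[y*z]≡y*[x*z] (2 ^ (k ∸ c)) q (2 ^ c)) (cong (q *_) (2^[k∸c]*2^c≡2^k c≤k)))
                          (count-recurrent (recurrent c≤k i₀<2^c) (2 ^ (k ∸ c)))
      -- A day serving (c, i₀) uses the matching of day s, so it also serves (j, i) and has lowest center c.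
      dominated : ∀ t → [ occ t c i₀ ] * w ≤ weight t j i
      dominated t with occ t c i₀ in on-t-c
      ... | false = z≤n
      ... | true rewrite sym (disjoint on-s-c on-t-c j i) | on-s | lowest-shared on-s-c on-t-c = ≤-refl

    total : ℕ
    total = ∑[ t < horizon ] ∑[ j < suc k ] ∑[ i < 2 ^ j ] weight t j i

    total≤ : total ≤ horizon * 2 ^ suc k
    total≤ = ≤-trans (∑-mono-≤ horizon (λ t _ → day-weight≤ t)) (≤-reflexive (∑-const horizon (2 ^ suc k)))

    total≥ : suc k * (2 ^ k * 2 ^ k) ≤ total
    total≥ = begin
      suc k * (2 ^ k * 2 ^ k)                                    ≡⟨ ∑-const (suc k) (2 ^ k * 2 ^ k) ⟨
      ∑[ j < suc k ] (2 ^ k * 2 ^ k)                             ≡⟨ ∑-cong (suc k) level ⟩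
      ∑[ j < suc k ] ∑[ i < 2 ^ j ] (2 ^ (k ∸ j) * 2 ^ k)        ≤⟨ ∑-mono-≤ (suc k) (λ j j<1+k →
                                                                      ∑-mono-≤ (2 ^ j) (λ i → edge-weight≥ (s≤s⁻¹ j<1+k))) ⟩
      ∑[ j < suc k ] ∑[ i < 2 ^ j ] ∑[ t < horizon ] weight t j i ≡⟨ reordered ⟨
      total                                                      ∎
      where
      open ≤-Reasoning
      level : ∀ j → j < suc k → 2 ^ k * 2 ^ k ≡ ∑[ i < 2 ^ j ] (2 ^ (k ∸ j) * 2 ^ k)
      level j j<1+k = begin-equality
        2 ^ k * 2 ^ k                   ≡⟨ cong (_* 2 ^ k) 2^j*2^[k∸j]≡2^k ⟨
        2 ^ j * 2 ^ (k ∸ j) * 2 ^ k     ≡⟨ *-assoc (2 ^ j) (2 ^ (k ∸ j)) (2 ^ k) ⟩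
        2 ^ j * (2 ^ (k ∸ j) * 2 ^ k)   ≡⟨ ∑-const (2 ^ j) (2 ^ (k ∸ j) * 2 ^ k) ⟨
        ∑[ i < 2 ^ j ] (2 ^ (k ∸ j) * 2 ^ k) ∎
        where
        2^j*2^[k∸j]≡2^k : 2 ^ j * 2 ^ (k ∸ j) ≡ 2 ^ k
        2^j*2^[k∸j]≡2^k = trans (*-comm (2 ^ j) (2 ^ (k ∸ j))) (2^[k∸c]*2^c≡2^k (s≤s⁻¹ j<1+k))
      reordered : total ≡ ∑[ j < suc k ] ∑[ i < 2 ^ j ] ∑[ t < horizon ] weight t j i
      reordered = trans (∑-comm horizon (suc k) (λ t j → ∑[ i < 2 ^ j ] weight t j i))
                        (∑-cong (suc k) (λ j _ → ∑-comm horizon (2 ^ j) (λ t i → weight t j i)))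

    counting-bound : suc k ≤ 2 * q
    counting-bound = *-cancelʳ-≤ (suc k) (2 * q) (2 ^ k * 2 ^ k) (begin
      suc k * (2 ^ k * 2 ^ k)   ≤⟨ ≤-trans total≥ total≤ ⟩
      q * 2 ^ k * (2 * 2 ^ k)   ≡⟨ regroup q (2 ^ k) ⟩
      2 * q * (2 ^ k * 2 ^ k)   ∎)
      where
      open ≤-Reasoning
      instance
        4^k≢0 : NonZero (2 ^ k * 2 ^ k)
        4^k≢0 = m*n≢0 (2 ^ k) (2 ^ k) {{m^n≢0 2 k}} {{m^n≢0 2 k}}
      regroup : ∀ x y → x * y * (2 * y) ≡ 2 * x * (y * y)
      regroup = solve-∀

module NatToRational where

  open import Defs using (ℕ→ℚ)
  open import Data.Nat as ℕ using (ℕ; NonZero)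
  open import Data.Nat.Coprimality using (1-coprimeTo; sym)
  open import Data.Integer as ℤ using (+_)
  import Data.Integer.Properties as ℤ
  open import Data.Rational using (mkℚ; Positive; _*_; _≤_; *≤*)
  open import Data.Rational.Properties using (normalize-coprime; normalize-pos)
  open import Relation.Binary.PropositionalEquality using (_≡_; refl; subst₂)
    renaming (sym to ≡-sym)

  private
    ℕ→ℚ≡mkℚ : ∀ n → ℕ→ℚ n ≡ mkℚ (+ n) 0 (sym (1-coprimeTo n))
    ℕ→ℚ≡mkℚ n = normalize-coprime (sym (1-coprimeTo n))

  ℕ→ℚ-homo-* : ∀ a b → ℕ→ℚ (a ℕ.* b) ≡ ℕ→ℚ a * ℕ→ℚ b
  ℕ→ℚ-homo-* a b rewrite ℕ→ℚ≡mkℚ a | ℕ→ℚ≡mkℚ b | ℤ.+◃n≡+n (a ℕ.* b) = refl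

  ℕ→ℚ-mono-≤ : ∀ {a b} → a ℕ.≤ b → ℕ→ℚ a ≤ ℕ→ℚ b
  ℕ→ℚ-mono-≤ {a} {b} a≤b rewrite ℕ→ℚ≡mkℚ a | ℕ→ℚ≡mkℚ b =
    *≤* (subst₂ ℤ._≤_ (≡-sym (ℤ.*-identityʳ (+ a))) (≡-sym (ℤ.*-identityʳ (+ b))) (ℤ.+≤+ a≤b))

  ℕ→ℚ-pos : ∀ n .{{_ : NonZero n}} → Positive (ℕ→ℚ n)
  ℕ→ℚ-pos n = normalize-pos n 1

module Recurrence where

  open import Defs
  open import Data.Nat using (suc; _+_; _<_)
  open import Data.Nat.Properties using (<-≤-trans; ≰⇒>; anyUpTo?)
  open import Data.Bool.Base using (true; T)
  open import Data.Bool.Properties using (¬-not; _≟_)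
  open import Data.Product.Base using (_,_)
  import Data.Rational as ℚ
  open import Data.Rational.Properties using (<-irrefl; ≤-<-trans)
  open import Relation.Nullary.Decidable using (yes; no)
  open import Relation.Nullary.Negation using (contradiction)
  open import Relation.Binary.PropositionalEquality using (refl; sym; trans)
  open FiniteSum using (Recurs)

  gap<period : ∀ {n} {S : Schedule n} {e P t d} → Recurs P (λ t → S t e) → Absent S e t d → d < P
  gap<period {t = t} recurs absent with recurs t
  ... | s , s<P , on = ≰⇒> (λ P≤d → contradiction (trans (sym on) (absent s (<-≤-trans s<P P≤d))) λ ())

  recurs-within-heat : ∀ {n} {I : Instance n} {S H e} D → HeatAtMost I S H → T (R I e) →
                       H ℚ.< g I e ℚ.* ℕ→ℚ (suc D) → Recurs D (λ t → S t e)
  recurs-within-heat {S = S} {e = e} D heat e∈R H< t with anyUpTo? (λ s → S (t + s) e ≟ true) D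
  ... | yes found = found
  ... | no  none  = contradiction (≤-<-trans (heat e e∈R t D absent) H<) (<-irrefl refl)
    where
    absent : Absent S e t D
    absent s s<D = ¬-not (λ on → none (s , s<D , on))

module StarForest where

  open import Defs
  open import Data.Nat
  open import Data.Nat.Properties
  open import Data.Nat.DivMod using (_%_)
  open import Data.Fin.Base using (toℕ; fromℕ<)
  open import Data.Fin.Properties using (toℕ-fromℕ<; toℕ-injective)
  open import Data.Bool.Base using (Bool; true; false; T)
  open import Data.Bool.Properties using (T-≡)
  open import Data.Product.Base using (∃-syntax; _×_; _,_; proj₁; proj₂)
  open import Data.Sum.Base using (inj₁; inj₂)
  open import Function.Bundles using (Equivalence)
  open import Relation.Nullary.Decidable
    using (Dec; yes; no; isYes; _×-dec_; toWitness; fromWitness; decidable-stable)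
  open import Relation.Nullary.Decidable.Core using (recompute)
  open import Relation.Nullary.Negation using (contradiction)
  open import Relation.Binary.PropositionalEquality
    using (_≡_; refl; sym; trans; cong; subst; subst₂)
  import Data.Rational as ℚ
  import Data.Rational.Properties as ℚ
  open FiniteSum using (Recurs)
  open NatArithmetic using (2^[k∸c]*2^c≡2^k; window-hits-residue)
  open NatToRational
  open Counting using (counting-bound)
  open import Data.Nat.Tactic.RingSolver using (solve-∀)
  open Recurrence

  T⇒≡true : ∀ {b} → T b → b ≡ true
  T⇒≡true = Equivalence.to T-≡

  ≡true⇒T : ∀ {b} → b ≡ true → T b
  ≡true⇒T = Equivalence.from T-≡

  -- Persons 0, …, k are the centers; the 2^j leaves of center j are the persons leaf j i, i < 2^j.
  module _ {n k : ℕ} (fits : suc k + 2 ^ suc k ≤ n) where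

    leaf : ℕ → ℕ → ℕ
    leaf j i = suc k + 2 ^ j + i

    IsSpoke : ℕ → ℕ → Set
    IsSpoke a b = a ≤ k × suc k + 2 ^ a ≤ b × b < suc k + 2 ^ suc a

    isSpoke? : ∀ a b → Dec (IsSpoke a b)
    isSpoke? a b = a ≤? k ×-dec (suc k + 2 ^ a ≤? b ×-dec b <? suc k + 2 ^ suc a)

    leaf-spoke : ∀ {j i} → j ≤ k → i < 2 ^ j → IsSpoke j (leaf j i)
    leaf-spoke {j} {i} j≤k i<2^j = j≤k , m≤m+n (suc k + 2 ^ j) i , (begin-strict
      suc k + 2 ^ j + i           ≡⟨ +-assoc (suc k) (2 ^ j) i ⟩
      suc k + (2 ^ j + i)         <⟨ +-monoʳ-< (suc k) (+-monoʳ-< (2 ^ j) (<-≤-trans i<2^j (m≤m+n (2 ^ j) 0))) ⟩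
      suc k + 2 ^ suc j           ∎)
      where open ≤-Reasoning

    spoke-offset : ∀ {a b} → IsSpoke a b → ∃[ r ] (r < 2 ^ a × b ≡ leaf a r)
    spoke-offset {a} {b} (_ , lo , hi) = b ∸ (suc k + 2 ^ a) , r<2^a , sym (m+[n∸m]≡n lo)
      where
      r<2^a : b ∸ (suc k + 2 ^ a) < 2 ^ a
      r<2^a = +-cancelˡ-< (suc k + 2 ^ a) _ _ (begin-strict
        suc k + 2 ^ a + (b ∸ (suc k + 2 ^ a))  ≡⟨ m+[n∸m]≡n lo ⟩
        b                                      <⟨ hi ⟩
        suc k + (2 ^ a + (2 ^ a + 0))          ≡⟨ +-assoc (suc k) (2 ^ a) (2 ^ a + 0) ⟨
        suc k + 2 ^ a + (2 ^ a + 0)            ≡⟨ cong (suc k + 2 ^ a +_) (+-identityʳ (2 ^ a)) ⟩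
        suc k + 2 ^ a + 2 ^ a                  ∎)
        where open ≤-Reasoning

    spoke-center-≤ : ∀ {a a' b} → IsSpoke a b → IsSpoke a' b → a ≤ a'
    spoke-center-≤ {a} {a'} {b} (_ , lo , _) (_ , _ , hi') = ≮⇒≥ λ a'<a → <-irrefl refl (begin-strict
      b                      <⟨ hi' ⟩
      suc k + 2 ^ suc a'     ≤⟨ +-monoʳ-≤ (suc k) (^-monoʳ-≤ 2 a'<a) ⟩
      suc k + 2 ^ a          ≤⟨ lo ⟩
      b                      ∎)
      where open ≤-Reasoning

    spoke-center-unique : ∀ {a a' b} → IsSpoke a b → IsSpoke a' b → a ≡ a'
    spoke-center-unique spoke spoke' = ≤-antisym (spoke-center-≤ spoke spoke') (spoke-center-≤ spoke' spoke)

    center<leaf : ∀ {a a' b} → a ≤ k → IsSpoke a' b → a < b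
    center<leaf {a' = a'} a≤k (_ , lo , _) = <-≤-trans (s≤s a≤k) (≤-trans (m≤m+n (suc k) (2 ^ a')) lo)

    <n : ∀ {m} → m < suc k + 2 ^ suc k → m < n
    <n m< = <-≤-trans m< fits

    center<n : ∀ {j} → j ≤ k → j < n
    center<n j≤k = <n (<-≤-trans (s≤s j≤k) (m≤m+n (suc k) _))

    leaf<n : ∀ {j i} → j ≤ k → i < 2 ^ j → leaf j i < n
    leaf<n j≤k i<2^j = <n (<-≤-trans (proj₂ (proj₂ (leaf-spoke j≤k i<2^j))) (+-monoʳ-≤ (suc k) (^-monoʳ-≤ 2 (s≤s j≤k))))

    spoke-ordered : ∀ {j i} (j≤k : j ≤ k) (i<2^j : i < 2 ^ j) →
                    toℕ (fromℕ< (center<n j≤k)) < toℕ (fromℕ< (leaf<n j≤k i<2^j))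
    spoke-ordered j≤k i<2^j = subst₂ _<_ (sym (toℕ-fromℕ< _)) (sym (toℕ-fromℕ< _)) (center<leaf j≤k (leaf-spoke j≤k i<2^j))

    spoke : ∀ j i → .(j ≤ k) → .(i < 2 ^ j) → Edge n
    spoke j i j≤k i<2^j = fromℕ< (center<n j≤k) , fromℕ< (leaf<n j≤k i<2^j) , recompute (_ <? _) (spoke-ordered j≤k i<2^j)

    toℕ-src-spoke : ∀ {j i} .(j≤k : j ≤ k) .(i<2^j : i < 2 ^ j) → toℕ (src (spoke j i j≤k i<2^j)) ≡ j
    toℕ-src-spoke j≤k _ = toℕ-fromℕ< (center<n j≤k)

    toℕ-tgt-spoke : ∀ {j i} .(j≤k : j ≤ k) .(i<2^j : i < 2 ^ j) → toℕ (tgt (spoke j i j≤k i<2^j)) ≡ leaf j i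
    toℕ-tgt-spoke j≤k i<2^j = toℕ-fromℕ< (leaf<n j≤k i<2^j)

    star-forest : Instance n
    star-forest = record
      { R     = λ e → isYes (isSpoke? (toℕ (src e)) (toℕ (tgt e)))
      ; g     = λ e → ℕ→ℚ (2 ^ (k ∸ toℕ (src e)))
      ; g-pos = λ e _ → ℚ.positive⁻¹ _ {{ℕ→ℚ-pos (2 ^ (k ∸ toℕ (src e))) {{m^n≢0 2 (k ∸ toℕ (src e))}}}}
      }

    residue : ℕ → ℕ → ℕ
    residue a t = _%_ t (2 ^ a) {{m^n≢0 2 a}}

    Served : ℕ → ℕ → ℕ → Set
    Served t a b = IsSpoke a b × b ≡ leaf a (residue a t)

    served? : ∀ t a b → Dec (Served t a b)
    served? t a b = isSpoke? a b ×-dec b ≟ leaf a (residue a t)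

    round-robin : Schedule n
    round-robin t e = isYes (served? t (toℕ (src e)) (toℕ (tgt e)))

    round-robin-valid : Valid star-forest round-robin
    round-robin-valid t = (λ e on → fromWitness (proj₁ (toWitness on))) ,
                          (λ e f on-e on-f e≠f shared → e≠f (shared⇒same e f (toWitness on-e) (toWitness on-f) shared))
      where
      shared⇒same : ∀ e f → Served t (toℕ (src e)) (toℕ (tgt e)) → Served t (toℕ (src f)) (toℕ (tgt f)) →
                    ShareVertex e f → SameEdge e f
      shared⇒same e f (_ , tgt-e) (_ , tgt-f) (inj₁ src≡) =
        src≡ , toℕ-injective (trans tgt-e (trans (cong (λ a → leaf a (residue a t)) (cong toℕ src≡)) (sym tgt-f)))
      shared⇒same e f ((a≤k , _) , _) (spoke-f , _) (inj₂ (inj₁ src≡tgt)) =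
        contradiction (cong toℕ src≡tgt) (<⇒≢ (center<leaf a≤k spoke-f))
      shared⇒same e f (spoke-e , _) ((a≤k , _) , _) (inj₂ (inj₂ (inj₁ tgt≡src))) =
        contradiction (cong toℕ (sym tgt≡src)) (<⇒≢ (center<leaf a≤k spoke-e))
      shared⇒same e f (spoke-e , _) (spoke-f , _) (inj₂ (inj₂ (inj₂ tgt≡))) =
        toℕ-injective (spoke-center-unique spoke-e (subst (IsSpoke (toℕ (src f))) (cong toℕ (sym tgt≡)) spoke-f)) , tgt≡

    round-robin-heat : HeatAtMost star-forest round-robin (ℕ→ℚ (2 ^ k))
    round-robin-heat e e∈R t d absent with spoke-offset (toWitness e∈R)
    ... | r , r<2^a , b≡leaf = begin
      ℕ→ℚ (2 ^ (k ∸ a)) ℚ.* ℕ→ℚ (suc d)   ≡⟨ ℕ→ℚ-homo-* (2 ^ (k ∸ a)) (suc d) ⟨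
      ℕ→ℚ (2 ^ (k ∸ a) * suc d)          ≤⟨ ℕ→ℚ-mono-≤ (*-monoʳ-≤ (2 ^ (k ∸ a)) 1+d≤2^a) ⟩
      ℕ→ℚ (2 ^ (k ∸ a) * 2 ^ a)          ≡⟨ cong ℕ→ℚ (2^[k∸c]*2^c≡2^k (proj₁ (toWitness e∈R))) ⟩
      ℕ→ℚ (2 ^ k)                        ∎
      where
      open ℚ.≤-Reasoning
      a = toℕ (src e)
      recurs : Recurs (2 ^ a) (λ t → round-robin t e)
      recurs t' with window-hits-residue (2 ^ a) {{m^n≢0 2 a}} t' r<2^a
      ... | s , s<2^a , hit = s , s<2^a , T⇒≡true (fromWitness (toWitness e∈R , trans b≡leaf (cong (leaf a) (sym hit))))
      1+d≤2^a : suc d ≤ 2 ^ a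
      1+d≤2^a = gap<period {S = round-robin} {e = e} recurs absent

    spoke∈R : ∀ {j i} (j≤k : j ≤ k) (i<2^j : i < 2 ^ j) → T (R star-forest (spoke j i j≤k i<2^j))
    spoke∈R j≤k i<2^j = subst₂ (λ a b → T (isYes (isSpoke? a b))) (sym (toℕ-src-spoke j≤k i<2^j)) (sym (toℕ-tgt-spoke j≤k i<2^j))
                              (fromWitness (leaf-spoke j≤k i<2^j))

    g-spoke : ∀ {j i} .(j≤k : j ≤ k) .(i<2^j : i < 2 ^ j) → g star-forest (spoke j i j≤k i<2^j) ≡ ℕ→ℚ (2 ^ (k ∸ j))
    g-spoke j≤k i<2^j = cong (λ a → ℕ→ℚ (2 ^ (k ∸ a))) (toℕ-src-spoke j≤k i<2^j)

    spokes : (Edge n → Bool) → ℕ → ℕ → Bool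
    spokes M j i with j ≤? k | i <? 2 ^ j
    ... | yes j≤k | yes i<2^j = M (spoke j i j≤k i<2^j)
    ... | _       | _         = false

    spokes-≡ : ∀ M {j i} (j≤k : j ≤ k) (i<2^j : i < 2 ^ j) → spokes M j i ≡ M (spoke j i j≤k i<2^j)
    spokes-≡ M {j} {i} j≤k i<2^j with j ≤? k | i <? 2 ^ j
    ... | yes _  | yes _  = refl
    ... | no j≰k | _      = contradiction j≤k j≰k
    ... | yes _  | no i≮ = contradiction i<2^j i≮

    spokes-in-range : ∀ M {j i} → spokes M j i ≡ true → j ≤ k × i < 2 ^ j
    spokes-in-range M {j} {i} on with j ≤? k | i <? 2 ^ j
    ... | yes j≤k | yes i<2^j = j≤k , i<2^j
    ... | yes _   | no _      = contradiction on λ ()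
    ... | no _    | _         = contradiction on λ ()

    spokes-cong : ∀ {M M'} → (∀ e → M e ≡ M' e) → ∀ j i → spokes M j i ≡ spokes M' j i
    spokes-cong M≗M' j i with j ≤? k | i <? 2 ^ j
    ... | yes _ | yes _ = M≗M' _
    ... | yes _ | no _  = refl
    ... | no _  | _     = refl

    spokes⇒T : ∀ M {j i} (j≤k : j ≤ k) (i<2^j : i < 2 ^ j) → spokes M j i ≡ true → T (M (spoke j i j≤k i<2^j))
    spokes⇒T M j≤k i<2^j on = ≡true⇒T (trans (sym (spokes-≡ M j≤k i<2^j)) on)

    spokes-matching : ∀ {M} → IsMatching star-forest M → ∀ {j i i'} → spokes M j i ≡ true → spokes M j i' ≡ true → i ≡ i'
    spokes-matching {M} (_ , separated) {j} {i} {i'} on on' with spokes-in-range M {j} {i} on | spokes-in-range M {j} {i'} on'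
    ... | j≤k , i<2^j | _ , i'<2^j = decidable-stable (i ≟ i') λ i≢i' →
      separated (spoke j i j≤k i<2^j) (spoke j i' j≤k i'<2^j) (spokes⇒T M j≤k i<2^j on) (spokes⇒T M j≤k i'<2^j on')
                (λ (_ , tgt≡) → i≢i' (+-cancelˡ-≡ (suc k + 2 ^ j) i i'
                   (trans (sym (toℕ-tgt-spoke j≤k i<2^j)) (trans (cong toℕ tgt≡) (toℕ-tgt-spoke j≤k i'<2^j)))))
                (inj₁ refl)

    spokes-disjoint : ∀ {S : Schedule n} → DisjointMatchings star-forest S →
                      ∀ {t t' j i} → spokes (S t) j i ≡ true → spokes (S t') j i ≡ true →
                      ∀ j' i' → spokes (S t) j' i' ≡ spokes (S t') j' i'
    spokes-disjoint {S} (same-matching , _) {t} {t'} {j} {i} on on' with spokes-in-range (S t) {j} {i} on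
    ... | j≤k , i<2^j =
      spokes-cong (same-matching t t' (spoke j i j≤k i<2^j) (spokes⇒T (S t) j≤k i<2^j on) (spokes⇒T (S t') j≤k i<2^j on'))

    spoke-heat-threshold : ∀ {q ρ j i} → ρ ℚ.< ℕ→ℚ q → (j≤k : j ≤ k) (i<2^j : i < 2 ^ j) →
                           ρ ℚ.* ℕ→ℚ (2 ^ k) ℚ.< g star-forest (spoke j i j≤k i<2^j) ℚ.* ℕ→ℚ (suc (q * 2 ^ j))
    spoke-heat-threshold {q} {ρ} {j} {i} ρ<q j≤k i<2^j = begin-strict
      ρ ℚ.* ℕ→ℚ (2 ^ k)                                   <⟨ ℚ.*-monoˡ-<-pos (ℕ→ℚ (2 ^ k)) {{2^k>0}} ρ<q ⟩
      ℕ→ℚ q ℚ.* ℕ→ℚ (2 ^ k)                               ≡⟨ ℕ→ℚ-homo-* q (2 ^ k) ⟨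
      ℕ→ℚ (q * 2 ^ k)                                     ≡⟨ cong ℕ→ℚ regroup ⟩
      ℕ→ℚ (2 ^ (k ∸ j) * (q * 2 ^ j))                     ≤⟨ ℕ→ℚ-mono-≤ (*-monoʳ-≤ (2 ^ (k ∸ j)) (n≤1+n (q * 2 ^ j))) ⟩
      ℕ→ℚ (2 ^ (k ∸ j) * suc (q * 2 ^ j))                 ≡⟨ ℕ→ℚ-homo-* (2 ^ (k ∸ j)) (suc (q * 2 ^ j)) ⟩
      ℕ→ℚ (2 ^ (k ∸ j)) ℚ.* ℕ→ℚ (suc (q * 2 ^ j))         ≡⟨ cong (ℚ._* ℕ→ℚ (suc (q * 2 ^ j))) (g-spoke j≤k i<2^j) ⟨
      g star-forest (spoke j i j≤k i<2^j) ℚ.* ℕ→ℚ (suc (q * 2 ^ j)) ∎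
      where
      open ℚ.≤-Reasoning
      2^k>0 : ℚ.Positive (ℕ→ℚ (2 ^ k))
      2^k>0 = ℕ→ℚ-pos (2 ^ k) {{m^n≢0 2 k}}
      x*[y*z]≡y*[x*z] : ∀ x y z → x * (y * z) ≡ y * (x * z)
      x*[y*z]≡y*[x*z] = solve-∀
      regroup : q * 2 ^ k ≡ 2 ^ (k ∸ j) * (q * 2 ^ j)
      regroup = trans (cong (q *_) (sym (2^[k∸c]*2^c≡2^k j≤k))) (x*[y*z]≡y*[x*z] q (2 ^ (k ∸ j)) (2 ^ j))

    spokes-recurrent : ∀ {S : Schedule n} {q ρ} → HeatAtMost star-forest S (ρ ℚ.* ℕ→ℚ (2 ^ k)) → ρ ℚ.< ℕ→ℚ q →
                       ∀ {j i} → j ≤ k → i < 2 ^ j → Recurs (q * 2 ^ j) (λ t → spokes (S t) j i)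
    spokes-recurrent {S} {q} heat ρ<q {j} {i} j≤k i<2^j t =
      let s , s<P , on = recurs-within-heat {I = star-forest} {S = S} (q * 2 ^ j) heat (spoke∈R j≤k i<2^j)
                                            (spoke-heat-threshold {q = q} ρ<q j≤k i<2^j) t
      in  s , s<P , trans (spokes-≡ (S (t + s)) j≤k i<2^j) on

    star-forest-ratio : ∀ (A : DMAlgorithm) q {ρ} → 2 * q < suc k → ρ ℚ.< ℕ→ℚ q → RatioExceeds A n ρ
    star-forest-ratio A q 2q<1+k ρ<q =
      star-forest , round-robin , ℕ→ℚ (2 ^ k) , round-robin-valid , round-robin-heat , λ heat →
        <⇒≱ 2q<1+k (counting-bound k q (λ t → spokes (S t))
                      (λ {t} {j} {i} {i'} → spokes-matching (valid A star-forest t) {j} {i} {i'})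
                      (λ {t} {t'} {j} {i} → spokes-disjoint {S = S} (dm A star-forest) {t} {t'} {j} {i})
                      (λ {j} {i} → spokes-recurrent {S = S} {q = q} heat ρ<q {j} {i}))
      where
      S = run A star-forest

module ChoiceOfScale where

  open import Defs
  open import Data.Nat
  open import Data.Nat.Properties
  open import Data.Nat.DivMod using (_/_)
  import Data.Integer as ℤ
  import Data.Rational as ℚ
  import Data.Rational.Properties as ℚ
  open import Relation.Binary.PropositionalEquality using (_≡_; cong)
  open import Data.Nat.Tactic.RingSolver using (solve-∀)
  open NatArithmetic using (n+2^n≤2^[1+n]; m<n*[1+m/n]; n*[1+m/n]≤n+m)
  open NatToRational
  open StarForest using (star-forest-ratio)

  ¼ : ℚ.ℚ
  ¼ = ℤ.+ 1 ℚ./ 4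

  ratio-from-log : ∀ A {n} L → 8 ≤ L → 2 ^ L ≤ n → RatioAtLeast A n (¼ ℚ.* ℕ→ℚ L)
  ratio-from-log A (suc (suc k)) (s≤s (s≤s 6≤k)) 2^L≤n ρ ρ<L/4 =
    star-forest-ratio (≤-trans (n+2^n≤2^[1+n] (suc k)) 2^L≤n) A q 2q<1+k ρ<q
    where
    L = suc (suc k)
    -- q exceeds L/4 > ρ, yet 2q < k + 1 = L - 1 because L ≥ 8.
    q = suc (L / 4)
    2q<1+k : 2 * q < suc k
    2q<1+k = *-cancelˡ-< 2 (2 * q) (suc k) (begin-strict
      2 * (2 * q)  ≡⟨ *-assoc 2 2 q ⟨
      4 * q        ≤⟨ n*[1+m/n]≤n+m L 4 ⟩
      6 + k        ≤⟨ +-monoˡ-≤ k 6≤k ⟩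
      k + k        <⟨ ≤-trans (n≤1+n (suc (k + k))) (≤-reflexive (2+[x+x]≡2*[1+x] k)) ⟩
      2 * suc k    ∎)
      where
      open ≤-Reasoning
      2+[x+x]≡2*[1+x] : ∀ x → 2 + (x + x) ≡ 2 * suc x
      2+[x+x]≡2*[1+x] = solve-∀
    ρ<q : ρ ℚ.< ℕ→ℚ q
    ρ<q = ℚ.<-≤-trans ρ<L/4 (begin
      ¼ ℚ.* ℕ→ℚ L                  ≤⟨ ℚ.*-monoˡ-≤-nonNeg ¼ (ℕ→ℚ-mono-≤ (<⇒≤ (m<n*[1+m/n] L 4))) ⟩
      ¼ ℚ.* ℕ→ℚ (4 * q)            ≡⟨ cong (¼ ℚ.*_) (ℕ→ℚ-homo-* 4 q) ⟩
      ¼ ℚ.* (ℕ→ℚ 4 ℚ.* ℕ→ℚ q)      ≡⟨ ℚ.*-assoc ¼ (ℕ→ℚ 4) (ℕ→ℚ q) ⟨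
      ℚ.1ℚ ℚ.* ℕ→ℚ q               ≡⟨ ℚ.*-identityˡ (ℕ→ℚ q) ⟩
      ℕ→ℚ q                        ∎)
      where open ℚ.≤-Reasoning

open import Defs
open import Data.Nat using (ℕ; _≤_)
open import Data.Nat.Logarithm using (⌊log₂_⌋)
open import Data.Product using (∃-syntax; _×_)
open import Data.Rational using (ℚ; 0ℚ; _*_; _<_)
open import Data.Nat using (z≤n; s≤s; >-nonZero)
open import Data.Nat.Properties using (≤-trans)
open import Data.Nat.Logarithm using (⌊log₂⌋-mono-≤)
open import Data.Product using (_,_)
open import Data.Rational.Properties using (positive⁻¹)
open NatArithmetic using (2^⌊log₂n⌋≤n)
open ChoiceOfScale using (¼; ratio-from-log)

theorem4 : (A : DMAlgorithm) →
    ∃[ c ] ∃[ N ] ((0ℚ < c) ×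
      ((n : ℕ) → N ≤ n → RatioAtLeast A n (c * ℕ→ℚ ⌊log₂ n ⌋)))
theorem4 A = ¼ , 256 , positive⁻¹ ¼ , λ n 256≤n →
  ratio-from-log A ⌊log₂ n ⌋ (⌊log₂⌋-mono-≤ 256≤n)
                 (2^⌊log₂n⌋≤n n {{>-nonZero (≤-trans (s≤s z≤n) 256≤n)}})
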